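{- Let $T$ be a regular $n$-tournament with adjacency matrix $A$. Then for every $i\in\{1,\dots,n\}$, \[ P_A(z)=\tfrac{1}{2}\left(z-\tfrac{n-1}{2}\right)\Big[(n+2z+1)\,P_{A_i}(z)+(n-2z-1)\,P_{A_i}(-z-1)\Big], \] where $A_i$ is the principal submatrix of $A$ obtained by deleting row $i$ and column $i$.
   Context: An $n$-tournament is a digraph on $n$ vertices in which every pair of distinct vertices is joined by exactly one arc; if the arc goes from $u$ to $v$, $u$ dominates $v$. Its adjacency matrix $A=(a_{ij})$ (w.r.t. an ordering $v_1,\dots,v_n$) has $a_{ij}=1$ if $v_i$ dominates $v_j$ and $0$ otherwise. A tournament is regular if all vertices dominate the same number of vertices (necessarily $\tfrac{n-1}{2}$). For a square matrix $M$, $P_M(z)=\det(zI-M)$. -}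

module Defs where

open import Data.Nat using (ℕ; zero; suc)
open import Data.Bool using (Bool; true; false; not; if_then_else_)
open import Data.Fin using (Fin; zero; suc; punchIn; _≟_)
open import Data.Integer using (+_)
open import Data.Rational using (ℚ; 0ℚ; 1ℚ; _+_; _*_; _-_; -_; _/_)
open import Data.Product using (∃)
open import Relation.Nullary using (does)
open import Relation.Binary.PropositionalEquality using (_≡_; _≢_)

Matrix : ℕ → Set
Matrix n = Fin n → Fin n → ℚ

sumFin : (n : ℕ) → (Fin n → ℚ) → ℚ
sumFin zero    f = 0ℚ
sumFin (suc n) f = f zero + sumFin n (λ j → f (suc j))

countFin : (n : ℕ) → (Fin n → Bool) → ℕ
countFin zero    f = 0
countFin (suc n) f = (if f zero then 1 else 0) Data.Nat.+ countFin n (λ j → f (suc j))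

sign : ℕ → ℚ
sign zero    = 1ℚ
sign (suc k) = - sign k

det : (n : ℕ) → Matrix n → ℚ
det zero    M = 1ℚ
det (suc n) M =
  sumFin (suc n) (λ j → sign (Data.Fin.toℕ j) * (M zero j * det n (λ r c → M (suc r) (punchIn j c))))

δ : {n : ℕ} → Fin n → Fin n → ℚ
δ i j = if does (i ≟ j) then 1ℚ else 0ℚ

-- characteristic polynomial P_M(z) = det(zI - M), evaluated at z
charPoly : (n : ℕ) → Matrix n → ℚ → ℚ
charPoly n M z = det n (λ r c → z * δ r c - M r c)

principalMinor : {n : ℕ} → Matrix (suc n) → Fin (suc n) → Matrix n
principalMinor M i r c = M (punchIn i r) (punchIn i c)

-- an n-tournament on vertex set Fin n: dom u v = true iff u dominates v
record Tournament (n : ℕ) : Set where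
  field
    dom    : Fin n → Fin n → Bool
    irrefl : ∀ i → dom i i ≡ false
    oneArc : ∀ i j → i ≢ j → dom i j ≡ not (dom j i)

open Tournament public

adjacency : {n : ℕ} → Tournament n → Matrix n
adjacency T i j = if dom T i j then 1ℚ else 0ℚ

outDegree : {n : ℕ} → Tournament n → Fin n → ℕ
outDegree {n} T i = countFin n (dom T i)

Regular : {n : ℕ} → Tournament n → Set
Regular {n} T = ∃ λ k → ∀ i → outDegree T i ≡ k

ℕtoℚ : ℕ → ℚ
ℕtoℚ n = (+ n) / 1

{-# OPTIONS --safe #-}
-- With N = zI − A and ρ = z − (n−1)/2, regularity (out-degree (n−1)/2, forced by double
-- counting) makes every row sum and every column sum of N equal to ρ. Adding all columns to
-- the first one and then all rows to the first one gives det N = ρ (n det C + ρ E), where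
-- C = zI − A₁ and E = det [[0, 1ᵀ], [1, C]]; a Schur complement on [[1, −1ᵀ], [1, C]] gives
-- det (C + J) = det C − E. Since A₁ + A₁ᵀ = J − I we have (−z−1)I − A₁ = −(C + J)ᵀ, and n − 1
-- is even, so P_{A₁}(−z−1) = det (C + J). Eliminating E yields the formula for the first
-- vertex; any other vertex is moved to the front by a simultaneous permutation of rows and
-- columns, which does not change P_A.

module Submission where

open import Defs
open import Data.Bool using (Bool; true; false; not; if_then_else_)
open import Data.Fin using (Fin; zero; suc; punchIn; toℕ)
import Data.Fin.Properties as FinP
import Data.Integer as ℤ
import Data.Integer.Properties as ℤP
open import Data.Nat using (ℕ; zero; suc)
import Data.Nat as ℕ
import Data.Nat.Properties as ℕP
open import Data.Product using (_,_)
open import Data.Rational using (ℚ; 0ℚ; 1ℚ; ½; _+_; _*_; _-_; -_; toℚᵘ)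
import Data.Rational.Properties as ℚP
import Data.Rational.Unnormalised as ℚᵘ
import Data.Rational.Unnormalised.Properties as ℚᵘP
open import Function using (_∘_)
open import Relation.Binary.PropositionalEquality
open import Data.Empty using (⊥-elim)
open import Relation.Nullary using (Dec; yes; no)
open import Relation.Nullary.Decidable using (dec-true; dec-false; dec⇒maybe)
open import Tactic.RingSolver using (solve-∀)
open import Tactic.RingSolver.Core.AlmostCommutativeRing using (AlmostCommutativeRing; fromCommutativeRing)
import Data.Integer.Tactic.RingSolver as ℤSolver
open import Algebra.Bundles using (CommutativeRing)
open import Algebra.Properties.Semiring.Sum (CommutativeRing.semiring ℚP.+-*-commutativeRing)
  using (sum; sum-syntax; sum-cong-≗; sum-replicate-zero; sum-remove; ∑-distrib-+; ∑-comm; *-distribˡ-sum; *-distribʳ-sum)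

open ≡-Reasoning

ℚ-ring : AlmostCommutativeRing _ _
ℚ-ring = fromCommutativeRing ℚP.+-*-commutativeRing (λ x → dec⇒maybe (0ℚ ℚP.≟ x))

-- Finite sums and the embedding ℕ → ℚ

sumFin≡sum : ∀ n (f : Fin n → ℚ) → sumFin n f ≡ sum f
sumFin≡sum zero    f = refl
sumFin≡sum (suc n) f = cong (f zero +_) (sumFin≡sum n (f ∘ suc))

∑-zero : ∀ n → ∑[ i < n ] 0ℚ ≡ 0ℚ
∑-zero = sum-replicate-zero

∑-neg : ∀ n (f : Fin n → ℚ) → ∑[ i < n ] (- f i) ≡ - sum f
∑-neg n f = begin
  ∑[ i < n ] (- f i)          ≡⟨ sum-cong-≗ (λ i → neg≡-1* (f i)) ⟩
  ∑[ i < n ] (- 1ℚ * f i)     ≡⟨ *-distribˡ-sum (- 1ℚ) f ⟨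
  - 1ℚ * sum f                ≡⟨ neg≡-1* (sum f) ⟨
  - sum f                     ∎
  where
  neg≡-1* : ∀ x → - x ≡ - 1ℚ * x
  neg≡-1* = solve-∀ ℚ-ring

∑-sub : ∀ n (f g : Fin n → ℚ) → ∑[ i < n ] (f i - g i) ≡ sum f - sum g
∑-sub n f g = trans (∑-distrib-+ f (λ i → - g i)) (cong (sum f +_) (∑-neg n g))

toℚᵘ-ℕtoℚ : ∀ n → toℚᵘ (ℕtoℚ n) ℚᵘ.≃ ℚᵘ.mkℚᵘ (ℤ.+ n) 0
toℚᵘ-ℕtoℚ n = ℚP.toℚᵘ-fromℚᵘ (ℚᵘ.mkℚᵘ (ℤ.+ n) 0)

ℕtoℚ-+ : ∀ a b → ℕtoℚ (a ℕ.+ b) ≡ ℕtoℚ a + ℕtoℚ b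
ℕtoℚ-+ a b = ℚP.toℚᵘ-injective
  (ℚᵘP.≃-trans (toℚᵘ-ℕtoℚ (a ℕ.+ b)) (ℚᵘP.≃-trans (ℚᵘ.*≡* (+-over-1 (ℤ.+ a) (ℤ.+ b)))
    (ℚᵘP.≃-sym (ℚᵘP.≃-trans (ℚP.toℚᵘ-homo-+ (ℕtoℚ a) (ℕtoℚ b)) (ℚᵘP.+-cong (toℚᵘ-ℕtoℚ a) (toℚᵘ-ℕtoℚ b))))))
  where
  +-over-1 : ∀ x y → (x ℤ.+ y) ℤ.* (ℤ.+ 1 ℤ.* ℤ.+ 1) ≡ (x ℤ.* ℤ.+ 1 ℤ.+ y ℤ.* ℤ.+ 1) ℤ.* ℤ.+ 1
  +-over-1 = ℤSolver.solve-∀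

ℕtoℚ-* : ∀ a b → ℕtoℚ (a ℕ.* b) ≡ ℕtoℚ a * ℕtoℚ b
ℕtoℚ-* a b = ℚP.toℚᵘ-injective
  (ℚᵘP.≃-trans (toℚᵘ-ℕtoℚ (a ℕ.* b)) (ℚᵘP.≃-trans (ℚᵘ.*≡* (trans (cong (ℤ._* (ℤ.+ 1 ℤ.* ℤ.+ 1)) (ℤP.pos-* a b)) (*-over-1 (ℤ.+ a) (ℤ.+ b))))
    (ℚᵘP.≃-sym (ℚᵘP.≃-trans (ℚP.toℚᵘ-homo-* (ℕtoℚ a) (ℕtoℚ b)) (ℚᵘP.*-cong (toℚᵘ-ℕtoℚ a) (toℚᵘ-ℕtoℚ b))))))
  where
  *-over-1 : ∀ x y → (x ℤ.* y) ℤ.* (ℤ.+ 1 ℤ.* ℤ.+ 1) ≡ (x ℤ.* y) ℤ.* ℤ.+ 1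
  *-over-1 = ℤSolver.solve-∀

ℕtoℚ-injective : ∀ {a b} → ℕtoℚ a ≡ ℕtoℚ b → a ≡ b
ℕtoℚ-injective {a} {b} eq = ℤP.+-injective (begin
  ℤ.+ a            ≡⟨ ℤP.*-identityʳ (ℤ.+ a) ⟨
  ℤ.+ a ℤ.* ℤ.+ 1  ≡⟨ ℚᵘP.drop-*≡* (ℚᵘP.≃-trans (ℚᵘP.≃-sym (toℚᵘ-ℕtoℚ a)) (ℚᵘP.≃-trans (ℚP.toℚᵘ-cong eq) (toℚᵘ-ℕtoℚ b))) ⟩
  ℤ.+ b ℤ.* ℤ.+ 1  ≡⟨ ℤP.*-identityʳ (ℤ.+ b) ⟩
  ℤ.+ b            ∎)

∑-const : ∀ n (x : ℚ) → ∑[ i < n ] x ≡ ℕtoℚ n * x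
∑-const zero    x = sym (ℚP.*-zeroˡ x)
∑-const (suc n) x = begin
  x + ∑[ i < n ] x           ≡⟨ cong (x +_) (∑-const n x) ⟩
  x + ℕtoℚ n * x             ≡⟨ distrib x (ℕtoℚ n) ⟩
  (1ℚ + ℕtoℚ n) * x          ≡⟨ cong (_* x) (ℕtoℚ-+ 1 n) ⟨
  ℕtoℚ (suc n) * x           ∎
  where
  distrib : ∀ x a → x + a * x ≡ (1ℚ + a) * x
  distrib = solve-∀ ℚ-ring

ℕtoℚ-indicator : ∀ b → ℕtoℚ (if b then 1 else 0) ≡ (if b then 1ℚ else 0ℚ)
ℕtoℚ-indicator true  = refl
ℕtoℚ-indicator false = refl

∑-indicator : ∀ n (f : Fin n → Bool) → ∑[ j < n ] (if f j then 1ℚ else 0ℚ) ≡ ℕtoℚ (countFin n f)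
∑-indicator zero    f = refl
∑-indicator (suc n) f = begin
  (if f zero then 1ℚ else 0ℚ) + ∑[ j < n ] (if f (suc j) then 1ℚ else 0ℚ)
    ≡⟨ cong₂ _+_ (sym (ℕtoℚ-indicator (f zero))) (∑-indicator n (f ∘ suc)) ⟩
  ℕtoℚ (if f zero then 1 else 0) + ℕtoℚ (countFin n (f ∘ suc))
    ≡⟨ ℕtoℚ-+ (if f zero then 1 else 0) (countFin n (f ∘ suc)) ⟨
  ℕtoℚ (countFin (suc n) f)
    ∎

-- Kronecker delta, signs and relabelling

δ-refl : ∀ {n} (i : Fin n) → δ i i ≡ 1ℚ
δ-refl i = cong (λ b → if b then 1ℚ else 0ℚ) (dec-true (i FinP.≟ i) refl)

δ-≢ : ∀ {n} {i j : Fin n} → i ≢ j → δ i j ≡ 0ℚ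
δ-≢ {i = i} {j} i≢j = cong (λ b → if b then 1ℚ else 0ℚ) (dec-false (i FinP.≟ j) i≢j)

δ-injective : ∀ {m n} (f : Fin m → Fin n) → (∀ {r c} → f r ≡ f c → r ≡ c) → ∀ r c → δ (f r) (f c) ≡ δ r c
δ-injective f f-inj r c = by-cases (r FinP.≟ c)
  where
  by-cases : Dec (r ≡ c) → δ (f r) (f c) ≡ δ r c
  by-cases (yes refl) = trans (δ-refl (f r)) (sym (δ-refl r))
  by-cases (no r≢c)   = trans (δ-≢ (r≢c ∘ f-inj)) (sym (δ-≢ r≢c))

δ-sym : ∀ {n} (r c : Fin n) → δ r c ≡ δ c r
δ-sym r c = by-cases (r FinP.≟ c)
  where
  by-cases : Dec (r ≡ c) → δ r c ≡ δ c r
  by-cases (yes refl) = refl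
  by-cases (no r≢c)   = trans (δ-≢ r≢c) (sym (δ-≢ (r≢c ∘ sym)))

∑-δ : ∀ n (r : Fin n) → ∑[ c < n ] δ r c ≡ 1ℚ
∑-δ (suc n) r = begin
  ∑[ c < suc n ] δ r c                         ≡⟨ sum-remove {i = r} (δ r) ⟩
  δ r r + ∑[ c < n ] δ r (punchIn r c)         ≡⟨ cong₂ _+_ (δ-refl r)
                                                    (trans (sum-cong-≗ (λ c → δ-≢ (FinP.punchInᵢ≢i r c ∘ sym))) (∑-zero n)) ⟩
  1ℚ + 0ℚ                                      ≡⟨⟩
  1ℚ                                           ∎

sign-square : ∀ k → sign k * sign k ≡ 1ℚ
sign-square zero    = refl
sign-square (suc k) = trans (neg-square (sign k)) (sign-square k)
  where
  neg-square : ∀ s → - s * - s ≡ s * s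
  neg-square = solve-∀ ℚ-ring

sign-even : ∀ k → sign (k ℕ.+ k) ≡ 1ℚ
sign-even zero    = refl
sign-even (suc k) = begin
  - sign (k ℕ.+ suc k)     ≡⟨ cong (λ j → - sign j) (ℕP.+-suc k k) ⟩
  - - sign (k ℕ.+ k)       ≡⟨ double-neg (sign (k ℕ.+ k)) ⟩
  sign (k ℕ.+ k)           ≡⟨ sign-even k ⟩
  1ℚ                       ∎
  where
  double-neg : ∀ s → - - s ≡ s
  double-neg = solve-∀ ℚ-ring

toFront : ∀ {n} → Fin (suc n) → Fin (suc n) → Fin (suc n)
toFront i zero    = i
toFront i (suc r) = punchIn i r

toFront-injective : ∀ {n} (i : Fin (suc n)) {r s : Fin (suc n)} → toFront i r ≡ toFront i s → r ≡ s
toFront-injective i {zero}  {zero}  eq = refl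
toFront-injective i {zero}  {suc s} eq = ⊥-elim (FinP.punchInᵢ≢i i s (sym eq))
toFront-injective i {suc r} {zero}  eq = ⊥-elim (FinP.punchInᵢ≢i i r eq)
toFront-injective i {suc r} {suc s} eq = cong suc (FinP.punchIn-injective i r s eq)

∑-toFront : ∀ n (i : Fin (suc n)) (f : Fin (suc n) → ℚ) → ∑[ r < suc n ] f (toFront i r) ≡ sum f
∑-toFront n i f = sym (sum-remove {i = i} f)

-- Laplace expansions and transposition

minor : ∀ {n} → Matrix (suc n) → Fin (suc n) → Fin (suc n) → Matrix n
minor M i j r c = M (punchIn i r) (punchIn j c)

cofactor : ∀ {n} → Matrix (suc n) → Fin (suc n) → ℚ
cofactor {n} M j = sign (toℕ j) * det n (minor M zero j)

det-expand : ∀ n (M : Matrix (suc n)) → det (suc n) M ≡ ∑[ j < suc n ] (M zero j * cofactor M j)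
det-expand n M = trans (sumFin≡sum (suc n) (λ j → sign (toℕ j) * (M zero j * det n (minor M zero j))))
  (sum-cong-≗ (λ j → reorder (sign (toℕ j)) (M zero j) (det n (minor M zero j))))
  where
  reorder : ∀ s a d → s * (a * d) ≡ a * (s * d)
  reorder = solve-∀ ℚ-ring

det-cong : ∀ n {M N : Matrix n} → (∀ r c → M r c ≡ N r c) → det n M ≡ det n N
det-cong zero    eq = refl
det-cong (suc n) {M} {N} eq = begin
  det (suc n) M                ≡⟨ sumFin≡sum (suc n) (term M) ⟩
  ∑[ j < suc n ] term M j      ≡⟨ sum-cong-≗ (λ j → cong₂ (λ a d → sign (toℕ j) * (a * d))
                                    (eq zero j) (det-cong n (λ r c → eq (suc r) (punchIn j c)))) ⟩
  ∑[ j < suc n ] term N j      ≡⟨ sumFin≡sum (suc n) (term N) ⟨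
  det (suc n) N                ∎
  where
  term : Matrix (suc n) → Fin (suc n) → ℚ
  term X j = sign (toℕ j) * (X zero j * det n (minor X zero j))

det-expandCol0 : ∀ n (M : Matrix (suc n)) →
  det (suc n) M ≡ ∑[ i < suc n ] (M i zero * (sign (toℕ i) * det n (minor M i zero)))
det-expandCol0 zero    M = det-expand zero M
det-expandCol0 (suc n) M = trans (det-expand (suc n) M) (cong (M zero zero * cofactor M zero +_) (begin
  ∑[ j < suc n ] (M zero (suc j) * cofactor M (suc j))
    ≡⟨ sum-cong-≗ (λ j → cong (λ d → M zero (suc j) * (sign (toℕ (suc j)) * d)) (det-expandCol0 n (minor M zero (suc j)))) ⟩
  ∑[ j < suc n ] (M zero (suc j) * (sign (toℕ (suc j)) * ∑[ i < suc n ] (M (suc i) zero * (sign (toℕ i) * D i j))))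
    ≡⟨ sum-cong-≗ (λ j → trans (assoc (M zero (suc j)) (sign (toℕ (suc j))) _)
         (*-distribˡ-sum (M zero (suc j) * sign (toℕ (suc j))) (λ i → M (suc i) zero * (sign (toℕ i) * D i j)))) ⟩
  ∑[ j < suc n ] ∑[ i < suc n ] ((M zero (suc j) * sign (toℕ (suc j))) * (M (suc i) zero * (sign (toℕ i) * D i j)))
    ≡⟨ ∑-comm (λ j i → (M zero (suc j) * sign (toℕ (suc j))) * (M (suc i) zero * (sign (toℕ i) * D i j))) ⟩
  ∑[ i < suc n ] ∑[ j < suc n ] ((M zero (suc j) * sign (toℕ (suc j))) * (M (suc i) zero * (sign (toℕ i) * D i j)))
    ≡⟨ sum-cong-≗ (λ i → sum-cong-≗ (λ j → regroup (M zero (suc j)) (sign (toℕ j)) (M (suc i) zero) (sign (toℕ i)) (D i j))) ⟩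
  ∑[ i < suc n ] ∑[ j < suc n ] ((M (suc i) zero * sign (toℕ (suc i))) * (M zero (suc j) * (sign (toℕ j) * D i j)))
    ≡⟨ sum-cong-≗ (λ i → trans (assoc (M (suc i) zero) (sign (toℕ (suc i))) _)
         (*-distribˡ-sum (M (suc i) zero * sign (toℕ (suc i))) (λ j → M zero (suc j) * (sign (toℕ j) * D i j)))) ⟨
  ∑[ i < suc n ] (M (suc i) zero * (sign (toℕ (suc i)) * ∑[ j < suc n ] (M zero (suc j) * (sign (toℕ j) * D i j))))
    ≡⟨ sum-cong-≗ (λ i → cong (λ d → M (suc i) zero * (sign (toℕ (suc i)) * d)) (det-expand n (minor M (suc i) zero))) ⟨
  ∑[ i < suc n ] (M (suc i) zero * (sign (toℕ (suc i)) * det (suc n) (minor M (suc i) zero)))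
    ∎))
  where
  D : Fin (suc n) → Fin (suc n) → ℚ
  D i j = det n (λ r c → M (suc (punchIn i r)) (suc (punchIn j c)))
  assoc : ∀ a s x → a * (s * x) ≡ (a * s) * x
  assoc = solve-∀ ℚ-ring
  regroup : ∀ a s b t d → (a * - s) * (b * (t * d)) ≡ (b * - t) * (a * (s * d))
  regroup = solve-∀ ℚ-ring

det-transpose : ∀ n (M : Matrix n) → det n (λ r c → M c r) ≡ det n M
det-transpose zero    M = refl
det-transpose (suc n) M = begin
  det (suc n) (λ r c → M c r)
    ≡⟨ det-expand n (λ r c → M c r) ⟩
  ∑[ j < suc n ] (M j zero * (sign (toℕ j) * det n (λ r c → M (punchIn j c) (suc r))))
    ≡⟨ sum-cong-≗ (λ j → cong (λ d → M j zero * (sign (toℕ j) * d)) (det-transpose n (minor M j zero))) ⟩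
  ∑[ i < suc n ] (M i zero * (sign (toℕ i) * det n (minor M i zero)))
    ≡⟨ det-expandCol0 n M ⟨
  det (suc n) M
    ∎

det-neg : ∀ n (M : Matrix n) → det n (λ r c → - M r c) ≡ sign n * det n M
det-neg zero    M = refl
det-neg (suc n) M = begin
  det (suc n) (λ r c → - M r c)
    ≡⟨ det-expand n (λ r c → - M r c) ⟩
  ∑[ j < suc n ] (- M zero j * (sign (toℕ j) * det n (λ r c → - minor M zero j r c)))
    ≡⟨ sum-cong-≗ (λ j → trans (cong (λ d → - M zero j * (sign (toℕ j) * d)) (det-neg n (minor M zero j)))
                               (pull-sign (M zero j) (sign (toℕ j)) (sign n) (det n (minor M zero j)))) ⟩
  ∑[ j < suc n ] (- sign n * (M zero j * cofactor M j))
    ≡⟨ *-distribˡ-sum (- sign n) (λ j → M zero j * cofactor M j) ⟨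
  - sign n * ∑[ j < suc n ] (M zero j * cofactor M j)
    ≡⟨ cong (- sign n *_) (det-expand n M) ⟨
  - sign n * det (suc n) M
    ∎
  where
  pull-sign : ∀ a s t d → - a * (s * (t * d)) ≡ - t * (a * (s * d))
  pull-sign = solve-∀ ℚ-ring

-- Row operations

withRow0 : ∀ {n} → (Fin (suc n) → ℚ) → Matrix (suc n) → Matrix (suc n)
withRow0 v M zero    c = v c
withRow0 v M (suc r) c = M (suc r) c

det-withRow0-self : ∀ n (M : Matrix (suc n)) → det (suc n) (withRow0 (M zero) M) ≡ det (suc n) M
det-withRow0-self n M = det-cong (suc n) {withRow0 (M zero) M} {M} λ { zero c → refl ; (suc r) c → refl }

det-withRow0-linear : ∀ n α β (x y : Fin (suc n) → ℚ) (M : Matrix (suc n)) →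
  det (suc n) (withRow0 (λ c → α * x c + β * y c) M)
    ≡ α * det (suc n) (withRow0 x M) + β * det (suc n) (withRow0 y M)
det-withRow0-linear n α β x y M = begin
  det (suc n) (withRow0 (λ c → α * x c + β * y c) M)
    ≡⟨ det-expand n (withRow0 (λ c → α * x c + β * y c) M) ⟩
  ∑[ j < suc n ] ((α * x j + β * y j) * cofactor M j)
    ≡⟨ sum-cong-≗ (λ j → distrib α (x j) β (y j) (cofactor M j)) ⟩
  ∑[ j < suc n ] (α * (x j * cofactor M j) + β * (y j * cofactor M j))
    ≡⟨ ∑-distrib-+ (λ j → α * (x j * cofactor M j)) (λ j → β * (y j * cofactor M j)) ⟩
  ∑[ j < suc n ] (α * (x j * cofactor M j)) + ∑[ j < suc n ] (β * (y j * cofactor M j))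
    ≡⟨ cong₂ _+_ (*-distribˡ-sum α (λ j → x j * cofactor M j)) (*-distribˡ-sum β (λ j → y j * cofactor M j)) ⟨
  α * ∑[ j < suc n ] (x j * cofactor M j) + β * ∑[ j < suc n ] (y j * cofactor M j)
    ≡⟨ cong₂ (λ p q → α * p + β * q) (det-expand n (withRow0 x M)) (det-expand n (withRow0 y M)) ⟨
  α * det (suc n) (withRow0 x M) + β * det (suc n) (withRow0 y M)
    ∎
  where
  distrib : ∀ α a β b d → (α * a + β * b) * d ≡ α * (a * d) + β * (b * d)
  distrib = solve-∀ ℚ-ring

swap01 : ∀ {a} {A : Set a} {n} → (Fin (suc (suc n)) → A) → Fin (suc (suc n)) → A
swap01 f zero          = f (suc zero)
swap01 f (suc zero)    = f zero
swap01 f (suc (suc r)) = f (suc (suc r))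

det-swap01 : ∀ n (M : Matrix (suc (suc n))) → det (suc (suc n)) (swap01 M) ≡ - det (suc (suc n)) M
det-minor-swap01 : ∀ n (M : Matrix (suc (suc n))) (i : Fin n) →
  det (suc n) (minor (swap01 M) (suc (suc i)) zero) ≡ - det (suc n) (minor M (suc (suc i)) zero)

-- Expand along column 0: the terms of rows 0 and 1 trade places with a change of sign, and
-- every other term is a minor whose first two rows are swapped.
det-swap01 n M = begin
  det (suc (suc n)) (swap01 M)
    ≡⟨ det-expandCol0 (suc n) (swap01 M) ⟩
  term (swap01 M) zero + (term (swap01 M) (suc zero) + lower (swap01 M))
    ≡⟨ cong₂ _+_ top₀ (cong₂ _+_ top₁ lower-swap) ⟩
  - term M (suc zero) + (- term M zero + - lower M)
    ≡⟨ regroup (term M zero) (term M (suc zero)) (lower M) ⟩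
  - (term M zero + (term M (suc zero) + lower M))
    ≡⟨ cong -_ (det-expandCol0 (suc n) M) ⟨
  - det (suc (suc n)) M
    ∎
  where
  term : Matrix (suc (suc n)) → Fin (suc (suc n)) → ℚ
  term X i = X i zero * (sign (toℕ i) * det (suc n) (minor X i zero))
  lower : Matrix (suc (suc n)) → ℚ
  lower X = ∑[ i < n ] term X (suc (suc i))
  flip : ∀ a d → a * (1ℚ * d) ≡ - (a * (- 1ℚ * d))
  flip = solve-∀ ℚ-ring
  unflip : ∀ a d → a * (- 1ℚ * d) ≡ - (a * (1ℚ * d))
  unflip = solve-∀ ℚ-ring
  top₀ : term (swap01 M) zero ≡ - term M (suc zero)
  top₀ = trans (cong (λ d → M (suc zero) zero * (1ℚ * d))
           (det-cong (suc n) {minor (swap01 M) zero zero} {minor M (suc zero) zero} λ { zero c → refl ; (suc r) c → refl }))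
         (flip (M (suc zero) zero) (det (suc n) (minor M (suc zero) zero)))
  top₁ : term (swap01 M) (suc zero) ≡ - term M zero
  top₁ = trans (cong (λ d → M zero zero * (- 1ℚ * d))
           (det-cong (suc n) {minor (swap01 M) (suc zero) zero} {minor M zero zero} λ { zero c → refl ; (suc r) c → refl }))
         (unflip (M zero zero) (det (suc n) (minor M zero zero)))
  negate-inner : ∀ a s d → a * (s * - d) ≡ - (a * (s * d))
  negate-inner = solve-∀ ℚ-ring
  lower-swap : lower (swap01 M) ≡ - lower M
  lower-swap = trans (sum-cong-≗ (λ i → trans (cong (λ d → M (suc (suc i)) zero * (sign (toℕ (suc (suc i))) * d))
                                                    (det-minor-swap01 n M i))
                                              (negate-inner (M (suc (suc i)) zero) (sign (toℕ (suc (suc i)))) (det (suc n) (minor M (suc (suc i)) zero)))))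
                     (∑-neg n (λ i → term M (suc (suc i))))
  regroup : ∀ a b l → - b + (- a + - l) ≡ - (a + (b + l))
  regroup = solve-∀ ℚ-ring

det-minor-swap01 (suc n) M i = trans
  (det-cong (suc (suc n)) {minor (swap01 M) (suc (suc i)) zero} {swap01 (minor M (suc (suc i)) zero)}
    λ { zero c → refl ; (suc zero) c → refl ; (suc (suc r)) c → refl })
  (det-swap01 n (minor M (suc (suc i)) zero))

det≡-det-swap01 : ∀ n (M : Matrix (suc (suc n))) → det (suc (suc n)) M ≡ - det (suc (suc n)) (swap01 M)
det≡-det-swap01 n M = trans
  (det-cong (suc (suc n)) {M} {swap01 (swap01 M)} λ { zero c → refl ; (suc zero) c → refl ; (suc (suc r)) c → refl })
  (det-swap01 n (swap01 M))

x≡-x⇒x≡0 : ∀ {x} → x ≡ - x → x ≡ 0ℚ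
x≡-x⇒x≡0 {x} eq = begin
  x                ≡⟨ half-double x ⟩
  ½ * (x + x)      ≡⟨ cong (λ y → ½ * (x + y)) eq ⟩
  ½ * (x + - x)    ≡⟨ half-cancel x ⟩
  0ℚ               ∎
  where
  half-double : ∀ x → x ≡ ½ * (x + x)
  half-double = solve-∀ ℚ-ring
  half-cancel : ∀ x → ½ * (x + - x) ≡ 0ℚ
  half-cancel = solve-∀ ℚ-ring

det-row0≡row1 : ∀ n (M : Matrix (suc (suc n))) → (∀ c → M zero c ≡ M (suc zero) c) → det (suc (suc n)) M ≡ 0ℚ
det-row0≡row1 n M eq = x≡-x⇒x≡0 (trans
  (det-cong (suc (suc n)) {M} {swap01 M} λ { zero c → eq c ; (suc zero) c → sym (eq c) ; (suc (suc r)) c → refl })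
  (det-swap01 n M))

det-row0≡row : ∀ n (s : Fin n) (M : Matrix (suc n)) → (∀ c → M zero c ≡ M (suc s) c) → det (suc n) M ≡ 0ℚ
det-row0≡row (suc n)       zero    M eq = det-row0≡row1 n M eq
det-row0≡row (suc (suc n)) (suc s) M eq = begin
  det (suc (suc (suc n))) M
    ≡⟨ det≡-det-swap01 (suc n) M ⟩
  - det (suc (suc (suc n))) (swap01 M)
    ≡⟨ cong -_ (det-expand (suc (suc n)) (swap01 M)) ⟩
  - ∑[ j < suc (suc (suc n)) ] (swap01 M zero j * cofactor (swap01 M) j)
    ≡⟨ cong -_ (sum-cong-≗ λ j → cong (λ d → swap01 M zero j * (sign (toℕ j) * d))
                     (det-row0≡row (suc n) s (minor (swap01 M) zero j) (λ c → eq (punchIn j c)))) ⟩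
  - ∑[ j < suc (suc (suc n)) ] (swap01 M zero j * (sign (toℕ j) * 0ℚ))
    ≡⟨ cong -_ (trans (sum-cong-≗ λ j → vanish (swap01 M zero j) (sign (toℕ j))) (∑-zero (suc (suc (suc n))))) ⟩
  - 0ℚ
    ≡⟨⟩
  0ℚ
    ∎
  where
  vanish : ∀ a s → a * (s * 0ℚ) ≡ 0ℚ
  vanish = solve-∀ ℚ-ring

det-withRow0-colSums : ∀ n (M : Matrix (suc n)) →
  det (suc n) (withRow0 (λ c → ∑[ r < suc n ] M r c) M) ≡ det (suc n) M
det-withRow0-colSums n M = begin
  det (suc n) (withRow0 (λ c → ∑[ r < suc n ] M r c) M)
    ≡⟨ det-expand n (withRow0 (λ c → ∑[ r < suc n ] M r c) M) ⟩
  ∑[ j < suc n ] (∑[ r < suc n ] M r j * cofactor M j)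
    ≡⟨ sum-cong-≗ (λ j → *-distribʳ-sum (cofactor M j) (λ r → M r j)) ⟩
  ∑[ j < suc n ] ∑[ r < suc n ] (M r j * cofactor M j)
    ≡⟨ ∑-comm (λ j r → M r j * cofactor M j) ⟩
  ∑[ r < suc n ] ∑[ j < suc n ] (M r j * cofactor M j)
    ≡⟨ sum-cong-≗ (λ r → det-expand n (withRow0 (M r) M)) ⟨
  det (suc n) (withRow0 (M zero) M) + ∑[ s < n ] det (suc n) (withRow0 (M (suc s)) M)
    ≡⟨ cong₂ _+_ (det-withRow0-self n M)
         (trans (sum-cong-≗ (λ s → det-row0≡row n s (withRow0 (M (suc s)) M) (λ c → refl))) (∑-zero n)) ⟩
  det (suc n) M + 0ℚ
    ≡⟨ ℚP.+-identityʳ (det (suc n) M) ⟩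
  det (suc n) M
    ∎

addRowMultiples : ∀ {n} → Fin n → (Fin n → ℚ) → Matrix n → Matrix n
addRowMultiples p u M r c = M r c + u r * M p c

det-addRowMultiples : ∀ n (p : Fin (suc n)) (u : Fin (suc n) → ℚ) (M : Matrix (suc n)) →
  u p ≡ 0ℚ → det (suc n) (addRowMultiples p u M) ≡ det (suc n) M
det-addRowMultiplesᵣ : ∀ n (p : Fin (suc n)) (u : Fin (suc (suc n)) → ℚ) (M : Matrix (suc (suc n))) →
  u (suc p) ≡ 0ℚ → det (suc (suc n)) (addRowMultiples (suc p) u M) ≡ det (suc (suc n)) M

det-addRowMultiples zero    zero    u M u₀≡0 = det-cong 1 {addRowMultiples zero u M} {M} λ { zero c → add-zero (M zero c) (u zero) u₀≡0 }
  where
  add-zero : ∀ x t → t ≡ 0ℚ → x + t * x ≡ x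
  add-zero x t refl = trans (cong (x +_) (ℚP.*-zeroˡ x)) (ℚP.+-identityʳ x)
-- A pivot in row 0 is first swapped into row 1, so that row 0 can be expanded.
det-addRowMultiples (suc n) zero    u M u₀≡0 = begin
  det (suc (suc n)) (addRowMultiples zero u M)
    ≡⟨ det≡-det-swap01 n (addRowMultiples zero u M) ⟩
  - det (suc (suc n)) (swap01 (addRowMultiples zero u M))
    ≡⟨ cong -_ (det-cong (suc (suc n)) {swap01 (addRowMultiples zero u M)} {addRowMultiples (suc zero) (swap01 u) (swap01 M)}
         λ { zero c → refl ; (suc zero) c → refl ; (suc (suc r)) c → refl }) ⟩
  - det (suc (suc n)) (addRowMultiples (suc zero) (swap01 u) (swap01 M))
    ≡⟨ cong -_ (det-addRowMultiplesᵣ n zero (swap01 u) (swap01 M) u₀≡0) ⟩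
  - det (suc (suc n)) (swap01 M)
    ≡⟨ det≡-det-swap01 n M ⟨
  det (suc (suc n)) M
    ∎
det-addRowMultiples (suc n) (suc p) u M uₚ≡0 = det-addRowMultiplesᵣ n p u M uₚ≡0

det-addRowMultiplesᵣ n p u M uₚ≡0 = begin
  det (suc (suc n)) M′
    ≡⟨ det-cong (suc (suc n)) {M′} {withRow0 (λ c → 1ℚ * M zero c + u zero * M (suc p) c) M′}
         (λ { zero c → cong (_+ u zero * M (suc p) c) (sym (ℚP.*-identityˡ (M zero c))) ; (suc r) c → refl }) ⟩
  det (suc (suc n)) (withRow0 (λ c → 1ℚ * M zero c + u zero * M (suc p) c) M′)
    ≡⟨ det-withRow0-linear (suc n) 1ℚ (u zero) (M zero) (M (suc p)) M′ ⟩
  1ℚ * det (suc (suc n)) (withRow0 (M zero) M′) + u zero * det (suc (suc n)) (withRow0 (M (suc p)) M′)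
    ≡⟨ cong₂ (λ d e → 1ℚ * d + u zero * e) row0-kept (det-row0≡row (suc n) p (withRow0 (M (suc p)) M′) pivot-kept) ⟩
  1ℚ * det (suc (suc n)) M + u zero * 0ℚ
    ≡⟨ simplify (det (suc (suc n)) M) (u zero) ⟩
  det (suc (suc n)) M
    ∎
  where
  M′ : Matrix (suc (suc n))
  M′ = addRowMultiples (suc p) u M
  pivot-kept : ∀ c → M (suc p) c ≡ M′ (suc p) c
  pivot-kept c = sym (trans (cong (λ t → M (suc p) c + t * M (suc p) c) uₚ≡0)
                            (trans (cong (M (suc p) c +_) (ℚP.*-zeroˡ (M (suc p) c))) (ℚP.+-identityʳ (M (suc p) c))))
  row0-kept : det (suc (suc n)) (withRow0 (M zero) M′) ≡ det (suc (suc n)) M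
  row0-kept = begin
    det (suc (suc n)) (withRow0 (M zero) M′)
      ≡⟨ det-expand (suc n) (withRow0 (M zero) M′) ⟩
    ∑[ j < suc (suc n) ] (M zero j * cofactor M′ j)
      ≡⟨ sum-cong-≗ (λ j → cong (λ d → M zero j * (sign (toℕ j) * d))
                         (det-addRowMultiples n p (u ∘ suc) (minor M zero j) uₚ≡0)) ⟩
    ∑[ j < suc (suc n) ] (M zero j * cofactor M j)
      ≡⟨ det-expand (suc n) M ⟨
    det (suc (suc n)) M
      ∎
  simplify : ∀ d t → 1ℚ * d + t * 0ℚ ≡ d
  simplify = solve-∀ ℚ-ring

det-toFrontRows : ∀ n (i : Fin (suc n)) (M : Matrix (suc n)) →
  det (suc n) (M ∘ toFront i) ≡ sign (toℕ i) * det (suc n) M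
det-toFrontRows n       zero    M = trans (det-cong (suc n) {M ∘ toFront zero} {M} λ { zero c → refl ; (suc r) c → refl })
                                          (sym (ℚP.*-identityˡ (det (suc n) M)))
det-toFrontRows (suc n) (suc i) M = begin
  det (suc (suc n)) (M ∘ toFront (suc i))
    ≡⟨ det-cong (suc (suc n)) {M ∘ toFront (suc i)} {swap01 X} (λ { zero c → refl ; (suc zero) c → refl ; (suc (suc r)) c → refl }) ⟩
  det (suc (suc n)) (swap01 X)
    ≡⟨ det-swap01 n X ⟩
  - det (suc (suc n)) X
    ≡⟨ cong -_ (det-expand (suc n) X) ⟩
  - ∑[ j < suc (suc n) ] (M zero j * (sign (toℕ j) * det (suc n) (minor M zero j ∘ toFront i)))
    ≡⟨ cong -_ (sum-cong-≗ λ j → trans (cong (λ d → M zero j * (sign (toℕ j) * d)) (det-toFrontRows n i (minor M zero j)))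
                                      (pull-sign (M zero j) (sign (toℕ j)) (sign (toℕ i)) (det (suc n) (minor M zero j)))) ⟩
  - ∑[ j < suc (suc n) ] (sign (toℕ i) * (M zero j * cofactor M j))
    ≡⟨ cong -_ (*-distribˡ-sum (sign (toℕ i)) (λ j → M zero j * cofactor M j)) ⟨
  - (sign (toℕ i) * ∑[ j < suc (suc n) ] (M zero j * cofactor M j))
    ≡⟨ cong (λ d → - (sign (toℕ i) * d)) (det-expand (suc n) M) ⟨
  - (sign (toℕ i) * det (suc (suc n)) M)
    ≡⟨ ℚP.neg-distribˡ-* (sign (toℕ i)) (det (suc (suc n)) M) ⟩
  - sign (toℕ i) * det (suc (suc n)) M
    ∎
  where
  X : Matrix (suc (suc n))
  X zero    = M zero
  X (suc r) = M (suc (toFront i r))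
  pull-sign : ∀ a s t d → a * (s * (t * d)) ≡ t * (a * (s * d))
  pull-sign = solve-∀ ℚ-ring

det-conjugate-toFront : ∀ n (i : Fin (suc n)) (M : Matrix (suc n)) →
  det (suc n) (λ r c → M (toFront i r) (toFront i c)) ≡ det (suc n) M
det-conjugate-toFront n i M = begin
  det (suc n) (λ r c → M (toFront i r) (toFront i c))
    ≡⟨ det-toFrontRows n i (λ r c → M r (toFront i c)) ⟩
  s * det (suc n) (λ r c → M r (toFront i c))
    ≡⟨ cong (s *_) (det-transpose (suc n) (λ r c → M r (toFront i c))) ⟨
  s * det (suc n) ((λ r c → M c r) ∘ toFront i)
    ≡⟨ cong (s *_) (det-toFrontRows n i (λ r c → M c r)) ⟩
  s * (s * det (suc n) (λ r c → M c r))
    ≡⟨ cong (λ d → s * (s * d)) (det-transpose (suc n) M) ⟩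
  s * (s * det (suc n) M)
    ≡⟨ ℚP.*-assoc s s (det (suc n) M) ⟨
  (s * s) * det (suc n) M
    ≡⟨ cong (_* det (suc n) M) (sign-square (toℕ i)) ⟩
  1ℚ * det (suc n) M
    ≡⟨ ℚP.*-identityˡ (det (suc n) M) ⟩
  det (suc n) M
    ∎
  where
  s : ℚ
  s = sign (toℕ i)

-- Bordered matrices

bordered : ∀ {n} → ℚ → (Fin n → ℚ) → (Fin n → ℚ) → Matrix n → Matrix (suc n)
bordered a v w C zero    zero    = a
bordered a v w C zero    (suc c) = v c
bordered a v w C (suc r) zero    = w r
bordered a v w C (suc r) (suc c) = C r c

det-bordered-linear : ∀ n α β a a′ (v v′ w : Fin n → ℚ) (C : Matrix n) →
  det (suc n) (bordered (α * a + β * a′) (λ c → α * v c + β * v′ c) w C)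
    ≡ α * det (suc n) (bordered a v w C) + β * det (suc n) (bordered a′ v′ w C)
det-bordered-linear n α β a a′ v v′ w C = begin
  det (suc n) (bordered (α * a + β * a′) (λ c → α * v c + β * v′ c) w C)
    ≡⟨ det-cong (suc n) {bordered (α * a + β * a′) (λ c → α * v c + β * v′ c) w C} {withRow0 (λ c → α * x c + β * y c) B}
         (λ { zero zero → refl ; zero (suc c) → refl ; (suc r) zero → refl ; (suc r) (suc c) → refl }) ⟩
  det (suc n) (withRow0 (λ c → α * x c + β * y c) B)
    ≡⟨ det-withRow0-linear n α β x y B ⟩
  α * det (suc n) (withRow0 x B) + β * det (suc n) (withRow0 y B)
    ≡⟨ cong (λ d → α * det (suc n) (withRow0 x B) + β * d)
         (det-cong (suc n) {withRow0 y B} {bordered a′ v′ w C}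
           (λ { zero c → refl ; (suc r) zero → refl ; (suc r) (suc c) → refl })) ⟩
  α * det (suc n) (withRow0 x B) + β * det (suc n) (bordered a′ v′ w C)
    ≡⟨ cong (λ d → α * d + β * det (suc n) (bordered a′ v′ w C)) (det-withRow0-self n B) ⟩
  α * det (suc n) B + β * det (suc n) (bordered a′ v′ w C)
    ∎
  where
  B : Matrix (suc n)
  B = bordered a v w C
  x y : Fin (suc n) → ℚ
  x = B zero
  y = bordered a′ v′ w C zero

det-bordered-unitRow : ∀ n (w : Fin n → ℚ) (C : Matrix n) →
  det (suc n) (bordered 1ℚ (λ _ → 0ℚ) w C) ≡ det n C
det-bordered-unitRow n w C = begin
  det (suc n) (bordered 1ℚ (λ _ → 0ℚ) w C)
    ≡⟨ det-expand n (bordered 1ℚ (λ _ → 0ℚ) w C) ⟩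
  1ℚ * (1ℚ * det n C) + ∑[ j < n ] (0ℚ * cofactor (bordered 1ℚ (λ _ → 0ℚ) w C) (suc j))
    ≡⟨ cong (1ℚ * (1ℚ * det n C) +_)
         (trans (sum-cong-≗ (λ j → ℚP.*-zeroˡ (cofactor (bordered 1ℚ (λ _ → 0ℚ) w C) (suc j)))) (∑-zero n)) ⟩
  1ℚ * (1ℚ * det n C) + 0ℚ
    ≡⟨ simplify (det n C) ⟩
  det n C
    ∎
  where
  simplify : ∀ d → 1ℚ * (1ℚ * d) + 0ℚ ≡ d
  simplify = solve-∀ ℚ-ring

det-bordered-unitCol : ∀ n (v : Fin n → ℚ) (C : Matrix n) →
  det (suc n) (bordered 1ℚ v (λ _ → 0ℚ) C) ≡ det n C
det-bordered-unitCol n v C = begin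
  det (suc n) (bordered 1ℚ v (λ _ → 0ℚ) C)
    ≡⟨ det-transpose (suc n) (bordered 1ℚ v (λ _ → 0ℚ) C) ⟨
  det (suc n) (λ r c → bordered 1ℚ v (λ _ → 0ℚ) C c r)
    ≡⟨ det-cong (suc n) {λ r c → bordered 1ℚ v (λ _ → 0ℚ) C c r} {bordered 1ℚ (λ _ → 0ℚ) v (λ r c → C c r)}
         (λ { zero zero → refl ; zero (suc c) → refl ; (suc r) zero → refl ; (suc r) (suc c) → refl }) ⟩
  det (suc n) (bordered 1ℚ (λ _ → 0ℚ) v (λ r c → C c r))
    ≡⟨ det-bordered-unitRow n v (λ r c → C c r) ⟩
  det n (λ r c → C c r)
    ≡⟨ det-transpose n C ⟩
  det n C
    ∎

det-bordered-schur : ∀ n (v w : Fin n → ℚ) (C : Matrix n) →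
  det (suc n) (bordered 1ℚ v w C) ≡ det n (λ r c → C r c - w r * v c)
det-bordered-schur n v w C = begin
  det (suc n) (bordered 1ℚ v w C)
    ≡⟨ det-addRowMultiples n zero u (bordered 1ℚ v w C) refl ⟨
  det (suc n) (addRowMultiples zero u (bordered 1ℚ v w C))
    ≡⟨ det-cong (suc n) {addRowMultiples zero u (bordered 1ℚ v w C)} {bordered 1ℚ v (λ _ → 0ℚ) (λ r c → C r c - w r * v c)}
         (λ { zero zero → corner ; zero (suc c) → top (v c) ; (suc r) zero → left (w r) ; (suc r) (suc c) → inner (C r c) (w r) (v c) }) ⟩
  det (suc n) (bordered 1ℚ v (λ _ → 0ℚ) (λ r c → C r c - w r * v c))
    ≡⟨ det-bordered-unitCol n v (λ r c → C r c - w r * v c) ⟩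
  det n (λ r c → C r c - w r * v c)
    ∎
  where
  u : Fin (suc n) → ℚ
  u zero    = 0ℚ
  u (suc r) = - w r
  corner : 1ℚ + 0ℚ * 1ℚ ≡ 1ℚ
  corner = refl
  top : ∀ x → x + 0ℚ * x ≡ x
  top = solve-∀ ℚ-ring
  left : ∀ y → y + - y * 1ℚ ≡ 0ℚ
  left = solve-∀ ℚ-ring
  inner : ∀ c y x → c + - y * x ≡ c - y * x
  inner = solve-∀ ℚ-ring

det-factorRowSum : ∀ n ρ (N : Matrix (suc n)) → (∀ r → ∑[ c < suc n ] N r c ≡ ρ) →
  det (suc n) N ≡ ρ * det (suc n) (bordered 1ℚ (λ c → N zero (suc c)) (λ _ → 1ℚ) (minor N zero zero))
det-factorRowSum n ρ N rowSum = begin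
  det (suc n) N
    ≡⟨ det-transpose (suc n) N ⟨
  det (suc n) Nᵀ
    ≡⟨ det-withRow0-colSums n Nᵀ ⟨
  det (suc n) (withRow0 (λ c → ∑[ r < suc n ] Nᵀ r c) Nᵀ)
    ≡⟨ det-cong (suc n) {withRow0 (λ c → ∑[ r < suc n ] Nᵀ r c) Nᵀ} {withRow0 (λ _ → ρ * 1ℚ + 0ℚ * 1ℚ) Nᵀ}
         (λ { zero c → trans (rowSum c) (ρ≡ρ*1+0*1 ρ) ; (suc r) c → refl }) ⟩
  det (suc n) (withRow0 (λ _ → ρ * 1ℚ + 0ℚ * 1ℚ) Nᵀ)
    ≡⟨ det-withRow0-linear n ρ 0ℚ (λ _ → 1ℚ) (λ _ → 1ℚ) Nᵀ ⟩
  ρ * det (suc n) (withRow0 (λ _ → 1ℚ) Nᵀ) + 0ℚ * det (suc n) (withRow0 (λ _ → 1ℚ) Nᵀ)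
    ≡⟨ drop-zero ρ (det (suc n) (withRow0 (λ _ → 1ℚ) Nᵀ)) ⟩
  ρ * det (suc n) (withRow0 (λ _ → 1ℚ) Nᵀ)
    ≡⟨ cong (ρ *_) (det-transpose (suc n) (withRow0 (λ _ → 1ℚ) Nᵀ)) ⟨
  ρ * det (suc n) (λ r c → withRow0 (λ _ → 1ℚ) Nᵀ c r)
    ≡⟨ cong (ρ *_) (det-cong (suc n) {λ r c → withRow0 (λ _ → 1ℚ) Nᵀ c r} {N₁}
         (λ { zero zero → refl ; zero (suc c) → refl ; (suc r) zero → refl ; (suc r) (suc c) → refl })) ⟩
  ρ * det (suc n) N₁
    ∎
  where
  Nᵀ N₁ : Matrix (suc n)
  Nᵀ r c = N c r
  N₁ = bordered 1ℚ (λ c → N zero (suc c)) (λ _ → 1ℚ) (minor N zero zero)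
  ρ≡ρ*1+0*1 : ∀ ρ → ρ ≡ ρ * 1ℚ + 0ℚ * 1ℚ
  ρ≡ρ*1+0*1 = solve-∀ ℚ-ring
  drop-zero : ∀ ρ d → ρ * d + 0ℚ * d ≡ ρ * d
  drop-zero = solve-∀ ℚ-ring

det-bordered-colSums : ∀ n ρ (v : Fin n → ℚ) (C : Matrix n) → (∀ c → v c + ∑[ r < n ] C r c ≡ ρ) →
  det (suc n) (bordered 1ℚ v (λ _ → 1ℚ) C)
    ≡ ℕtoℚ (suc n) * det n C + ρ * det (suc n) (bordered 0ℚ (λ _ → 1ℚ) (λ _ → 1ℚ) C)
det-bordered-colSums n ρ v C colSum = begin
  det (suc n) N₁
    ≡⟨ det-withRow0-colSums n N₁ ⟨
  det (suc n) (withRow0 (λ c → ∑[ r < suc n ] N₁ r c) N₁)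
    ≡⟨ det-cong (suc n) {withRow0 (λ c → ∑[ r < suc n ] N₁ r c) N₁}
                        {bordered (ℕtoℚ (suc n) * 1ℚ + ρ * 0ℚ) (λ _ → ℕtoℚ (suc n) * 0ℚ + ρ * 1ℚ) (λ _ → 1ℚ) C}
         (λ { zero zero → trans (∑-const (suc n) 1ℚ) (pick-first (ℕtoℚ (suc n)) ρ)
            ; zero (suc c) → trans (colSum c) (pick-second (ℕtoℚ (suc n)) ρ)
            ; (suc r) zero → refl ; (suc r) (suc c) → refl }) ⟩
  det (suc n) (bordered (ℕtoℚ (suc n) * 1ℚ + ρ * 0ℚ) (λ _ → ℕtoℚ (suc n) * 0ℚ + ρ * 1ℚ) (λ _ → 1ℚ) C)
    ≡⟨ det-bordered-linear n (ℕtoℚ (suc n)) ρ 1ℚ 0ℚ (λ _ → 0ℚ) (λ _ → 1ℚ) (λ _ → 1ℚ) C ⟩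
  ℕtoℚ (suc n) * det (suc n) (bordered 1ℚ (λ _ → 0ℚ) (λ _ → 1ℚ) C) + ρ * det (suc n) (bordered 0ℚ (λ _ → 1ℚ) (λ _ → 1ℚ) C)
    ≡⟨ cong (λ d → ℕtoℚ (suc n) * d + ρ * det (suc n) (bordered 0ℚ (λ _ → 1ℚ) (λ _ → 1ℚ) C))
         (det-bordered-unitRow n (λ _ → 1ℚ) C) ⟩
  ℕtoℚ (suc n) * det n C + ρ * det (suc n) (bordered 0ℚ (λ _ → 1ℚ) (λ _ → 1ℚ) C)
    ∎
  where
  N₁ : Matrix (suc n)
  N₁ = bordered 1ℚ v (λ _ → 1ℚ) C
  pick-first : ∀ a b → a * 1ℚ ≡ a * 1ℚ + b * 0ℚ
  pick-first = solve-∀ ℚ-ring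
  pick-second : ∀ a b → b ≡ a * 0ℚ + b * 1ℚ
  pick-second = solve-∀ ℚ-ring

det-+allOnes : ∀ n (C : Matrix n) →
  det n (λ r c → C r c + 1ℚ) ≡ det n C - det (suc n) (bordered 0ℚ (λ _ → 1ℚ) (λ _ → 1ℚ) C)
det-+allOnes n C = begin
  det n (λ r c → C r c + 1ℚ)
    ≡⟨ det-cong n (λ r c → cong (C r c +_) (sym (ℚP.*-identityˡ 1ℚ))) ⟩
  det n (λ r c → C r c - 1ℚ * - 1ℚ)
    ≡⟨ det-bordered-schur n (λ _ → - 1ℚ) (λ _ → 1ℚ) C ⟨
  det (suc n) (bordered 1ℚ (λ _ → - 1ℚ) (λ _ → 1ℚ) C)
    ≡⟨ det-bordered-linear n 1ℚ (- 1ℚ) 1ℚ 0ℚ (λ _ → 0ℚ) (λ _ → 1ℚ) (λ _ → 1ℚ) C ⟩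
  1ℚ * det (suc n) (bordered 1ℚ (λ _ → 0ℚ) (λ _ → 1ℚ) C) + - 1ℚ * det (suc n) (bordered 0ℚ (λ _ → 1ℚ) (λ _ → 1ℚ) C)
    ≡⟨ cong (λ d → 1ℚ * d + - 1ℚ * det (suc n) (bordered 0ℚ (λ _ → 1ℚ) (λ _ → 1ℚ) C)) (det-bordered-unitRow n (λ _ → 1ℚ) C) ⟩
  1ℚ * det n C + - 1ℚ * det (suc n) (bordered 0ℚ (λ _ → 1ℚ) (λ _ → 1ℚ) C)
    ≡⟨ as-difference (det n C) (det (suc n) (bordered 0ℚ (λ _ → 1ℚ) (λ _ → 1ℚ) C)) ⟩
  det n C - det (suc n) (bordered 0ℚ (λ _ → 1ℚ) (λ _ → 1ℚ) C)
    ∎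
  where
  as-difference : ∀ d e → 1ℚ * d + - 1ℚ * e ≡ d - e
  as-difference = solve-∀ ℚ-ring

det-constLineSums : ∀ n ρ (N : Matrix (suc n)) →
  (∀ r → ∑[ c < suc n ] N r c ≡ ρ) → (∀ c → ∑[ r < suc n ] N r c ≡ ρ) →
  det (suc n) N ≡ ρ * ((ℕtoℚ (suc n) + ρ) * det n (minor N zero zero) - ρ * det n (λ r c → minor N zero zero r c + 1ℚ))
det-constLineSums n ρ N rowSum colSum = begin
  det (suc n) N
    ≡⟨ det-factorRowSum n ρ N rowSum ⟩
  ρ * det (suc n) (bordered 1ℚ (λ c → N zero (suc c)) (λ _ → 1ℚ) C)
    ≡⟨ cong (ρ *_) (det-bordered-colSums n ρ (λ c → N zero (suc c)) C (colSum ∘ suc)) ⟩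
  ρ * (ℕtoℚ (suc n) * det n C + ρ * E)
    ≡⟨ regroup ρ (ℕtoℚ (suc n)) (det n C) E ⟩
  ρ * ((ℕtoℚ (suc n) + ρ) * det n C - ρ * (det n C - E))
    ≡⟨ cong (λ d → ρ * ((ℕtoℚ (suc n) + ρ) * det n C - ρ * d)) (det-+allOnes n C) ⟨
  ρ * ((ℕtoℚ (suc n) + ρ) * det n C - ρ * det n (λ r c → C r c + 1ℚ))
    ∎
  where
  C : Matrix n
  C = minor N zero zero
  E : ℚ
  E = det (suc n) (bordered 0ℚ (λ _ → 1ℚ) (λ _ → 1ℚ) C)
  regroup : ∀ ρ n d e → ρ * (n * d + ρ * e) ≡ ρ * ((n + ρ) * d - ρ * (d - e))
  regroup = solve-∀ ℚ-ring

-- Tournament matrices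

charMatrix : ∀ {n} → ℚ → Matrix n → Matrix n
charMatrix z M r c = z * δ r c - M r c

charPoly-conjugate-toFront : ∀ n (i : Fin (suc n)) (M : Matrix (suc n)) z →
  charPoly (suc n) (λ r c → M (toFront i r) (toFront i c)) z ≡ charPoly (suc n) M z
charPoly-conjugate-toFront n i M z = trans
  (det-cong (suc n) (λ r c → cong (λ d → z * d - M (toFront i r) (toFront i c)) (sym (δ-injective (toFront i) (toFront-injective i) r c))))
  (det-conjugate-toFront n i (charMatrix z M))

-- The one property of tournament adjacency matrices that is used: A + Aᵀ = J − I.
IsTournamentMatrix : ∀ {n} → Matrix n → Set
IsTournamentMatrix M = ∀ r c → M r c + M c r ≡ 1ℚ - δ r c

tournamentMatrix-entry : ∀ {n} (B : Matrix n) → IsTournamentMatrix B → ∀ r c → B r c ≡ (1ℚ - δ r c) - B c r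
tournamentMatrix-entry B tm r c = trans (move (B r c) (B c r)) (cong (_- B c r) (tm r c))
  where
  move : ∀ x y → x ≡ (x + y) - y
  move = solve-∀ ℚ-ring

-- (−z−1)I − B = −(zI − B + J)ᵀ because B + Bᵀ = J − I.
charPoly-reflect : ∀ n (B : Matrix n) → IsTournamentMatrix B → ∀ z →
  charPoly n B (- z - 1ℚ) ≡ sign n * det n (λ r c → charMatrix z B r c + 1ℚ)
charPoly-reflect n B tm z = begin
  det n (charMatrix (- z - 1ℚ) B)
    ≡⟨ det-cong n (λ r c → trans (cong (λ b → (- z - 1ℚ) * δ r c - b) (tournamentMatrix-entry B tm r c))
                                 (trans (reflect z (δ r c) (B c r)) (cong (λ d → - ((z * d - B c r) + 1ℚ)) (δ-sym r c)))) ⟩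
  det n (λ r c → - W c r)
    ≡⟨ det-neg n (λ r c → W c r) ⟩
  sign n * det n (λ r c → W c r)
    ≡⟨ cong (sign n *_) (det-transpose n W) ⟩
  sign n * det n W
    ∎
  where
  W : Matrix n
  W r c = charMatrix z B r c + 1ℚ
  reflect : ∀ z d b → (- z - 1ℚ) * d - ((1ℚ - d) - b) ≡ - ((z * d - b) + 1ℚ)
  reflect = solve-∀ ℚ-ring

tournamentMatrix-rowSum⇒k+k≡m : ∀ m (B : Matrix (suc m)) k → IsTournamentMatrix B → (∀ r → ∑[ c < suc m ] B r c ≡ ℕtoℚ k) → k ℕ.+ k ≡ m
tournamentMatrix-rowSum⇒k+k≡m m B k tm rowSum = ℕP.*-cancelˡ-≡ (k ℕ.+ k) m (suc m) (ℕtoℚ-injective (begin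
  ℕtoℚ (suc m ℕ.* (k ℕ.+ k))
    ≡⟨ trans (ℕtoℚ-* (suc m) (k ℕ.+ k)) (cong (n *_) (ℕtoℚ-+ k k)) ⟩
  n * (K + K)
    ≡⟨ ℚP.*-distribˡ-+ n K K ⟩
  n * K + n * K
    ≡⟨ cong₂ _+_ ∑-rowSums (trans (∑-comm (λ r c → B c r)) ∑-rowSums) ⟨
  ∑[ r < suc m ] ∑[ c < suc m ] B r c + ∑[ r < suc m ] ∑[ c < suc m ] B c r
    ≡⟨ trans (sum-cong-≗ (λ r → ∑-distrib-+ (B r) (λ c → B c r)))
             (∑-distrib-+ (λ r → ∑[ c < suc m ] B r c) (λ r → ∑[ c < suc m ] B c r)) ⟨
  ∑[ r < suc m ] ∑[ c < suc m ] (B r c + B c r)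
    ≡⟨ sum-cong-≗ (λ r → trans (sum-cong-≗ (tm r)) (∑-1-δ r)) ⟩
  ∑[ r < suc m ] ℕtoℚ m
    ≡⟨ ∑-const (suc m) (ℕtoℚ m) ⟩
  n * ℕtoℚ m
    ≡⟨ ℕtoℚ-* (suc m) m ⟨
  ℕtoℚ (suc m ℕ.* m)
    ∎))
  where
  n K : ℚ
  n = ℕtoℚ (suc m)
  K = ℕtoℚ k
  ∑-rowSums : ∑[ r < suc m ] ∑[ c < suc m ] B r c ≡ n * K
  ∑-rowSums = trans (sum-cong-≗ rowSum) (∑-const (suc m) K)
  ∑-1-δ : ∀ r → ∑[ c < suc m ] (1ℚ - δ r c) ≡ ℕtoℚ m
  ∑-1-δ r = begin
    ∑[ c < suc m ] (1ℚ - δ r c)       ≡⟨ ∑-sub (suc m) (λ _ → 1ℚ) (δ r) ⟩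
    ∑[ c < suc m ] 1ℚ - ∑[ c < suc m ] δ r c  ≡⟨ cong₂ _-_ (∑-const (suc m) 1ℚ) (∑-δ (suc m) r) ⟩
    n * 1ℚ - 1ℚ                        ≡⟨ cong (λ x → x * 1ℚ - 1ℚ) (ℕtoℚ-+ 1 m) ⟩
    (1ℚ + ℕtoℚ m) * 1ℚ - 1ℚ            ≡⟨ cancel (ℕtoℚ m) ⟩
    ℕtoℚ m                             ∎
    where
    cancel : ∀ x → (1ℚ + x) * 1ℚ - 1ℚ ≡ x
    cancel = solve-∀ ℚ-ring

tournamentMatrix-colSum : ∀ m (B : Matrix (suc m)) K → IsTournamentMatrix B → (∀ r → ∑[ c < suc m ] B r c ≡ K) →
  ℕtoℚ (suc m) ≡ 1ℚ + (K + K) → ∀ c → ∑[ r < suc m ] B r c ≡ K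
tournamentMatrix-colSum m B K tm rowSum n≡1+2K c = begin
  ∑[ r < suc m ] B r c
    ≡⟨ sum-cong-≗ (λ r → tournamentMatrix-entry B tm r c) ⟩
  ∑[ r < suc m ] ((1ℚ - δ r c) - B c r)
    ≡⟨ trans (∑-sub (suc m) (λ r → 1ℚ - δ r c) (B c)) (cong (_- ∑[ r < suc m ] B c r) (∑-sub (suc m) (λ _ → 1ℚ) (λ r → δ r c))) ⟩
  (∑[ r < suc m ] 1ℚ - ∑[ r < suc m ] δ r c) - ∑[ r < suc m ] B c r
    ≡⟨ cong₂ (λ a b → (a - b) - ∑[ r < suc m ] B c r) (∑-const (suc m) 1ℚ)
         (trans (sum-cong-≗ (λ r → δ-sym r c)) (∑-δ (suc m) c)) ⟩
  (ℕtoℚ (suc m) * 1ℚ - 1ℚ) - ∑[ r < suc m ] B c r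
    ≡⟨ cong₂ (λ a b → (a * 1ℚ - 1ℚ) - b) n≡1+2K (rowSum c) ⟩
  ((1ℚ + (K + K)) * 1ℚ - 1ℚ) - K
    ≡⟨ simplify K ⟩
  K
    ∎
  where
  simplify : ∀ K → ((1ℚ + (K + K)) * 1ℚ - 1ℚ) - K ≡ K
  simplify = solve-∀ ℚ-ring

∑-charMatrix-row : ∀ n z (B : Matrix n) K r → ∑[ c < n ] B r c ≡ K → ∑[ c < n ] charMatrix z B r c ≡ z - K
∑-charMatrix-row n z B K r rowSum = begin
  ∑[ c < n ] (z * δ r c - B r c)        ≡⟨ ∑-sub n (λ c → z * δ r c) (B r) ⟩
  ∑[ c < n ] (z * δ r c) - sum (B r)    ≡⟨ cong (_- sum (B r)) (*-distribˡ-sum z (δ r)) ⟨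
  z * sum (δ r) - sum (B r)             ≡⟨ cong₂ (λ d b → z * d - b) (∑-δ n r) rowSum ⟩
  z * 1ℚ - K                            ≡⟨ cong (_- K) (ℚP.*-identityʳ z) ⟩
  z - K                                 ∎

∑-charMatrix-col : ∀ n z (B : Matrix n) K c → ∑[ r < n ] B r c ≡ K → ∑[ r < n ] charMatrix z B r c ≡ z - K
∑-charMatrix-col n z B K c colSum = trans
  (sum-cong-≗ (λ r → cong (λ d → z * d - B r c) (δ-sym r c)))
  (∑-charMatrix-row n z (λ r c → B c r) K c colSum)

charPoly-regularTournamentMatrix : ∀ m (B : Matrix (suc m)) k → IsTournamentMatrix B →
  (∀ r → ∑[ c < suc m ] B r c ≡ ℕtoℚ k) → ∀ z →
  charPoly (suc m) B z
    ≡ ½ * ((z - ½ * (ℕtoℚ (suc m) - 1ℚ))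
        * ((ℕtoℚ (suc m) + ℕtoℚ 2 * z + 1ℚ) * charPoly m (principalMinor B zero) z
           + (ℕtoℚ (suc m) - ℕtoℚ 2 * z - 1ℚ) * charPoly m (principalMinor B zero) (- z - 1ℚ)))
charPoly-regularTournamentMatrix m B k tm rowSum z = begin
  charPoly (suc m) B z
    ≡⟨ det-constLineSums m (z - K) (charMatrix z B)
         (λ r → ∑-charMatrix-row (suc m) z B K r (rowSum r))
         (λ c → ∑-charMatrix-col (suc m) z B K c (tournamentMatrix-colSum m B K tm rowSum n≡1+2K c)) ⟩
  (z - K) * ((n + (z - K)) * P - (z - K) * det m (λ r c → charMatrix z B′ r c + 1ℚ))
    ≡⟨ cong (λ q → (z - K) * ((n + (z - K)) * P - (z - K) * q)) reflected ⟨
  (z - K) * ((n + (z - K)) * P - (z - K) * Q)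
    ≡⟨ cong (λ x → (z - K) * ((x + (z - K)) * P - (z - K) * Q)) n≡1+2K ⟩
  (z - K) * (((1ℚ + (K + K)) + (z - K)) * P - (z - K) * Q)
    ≡⟨ closing z K P Q ⟩
  ½ * ((z - ½ * ((1ℚ + (K + K)) - 1ℚ))
      * (((1ℚ + (K + K)) + (1ℚ + 1ℚ) * z + 1ℚ) * P + ((1ℚ + (K + K)) - (1ℚ + 1ℚ) * z - 1ℚ) * Q))
    ≡⟨ cong (λ x → ½ * ((z - ½ * (x - 1ℚ)) * ((x + (1ℚ + 1ℚ) * z + 1ℚ) * P + (x - (1ℚ + 1ℚ) * z - 1ℚ) * Q))) n≡1+2K ⟨
  ½ * ((z - ½ * (n - 1ℚ)) * ((n + ℕtoℚ 2 * z + 1ℚ) * P + (n - ℕtoℚ 2 * z - 1ℚ) * Q))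
    ∎
  where
  n K P Q : ℚ
  n = ℕtoℚ (suc m)
  K = ℕtoℚ k
  B′ : Matrix m
  B′ = principalMinor B zero
  P = charPoly m B′ z
  Q = charPoly m B′ (- z - 1ℚ)
  k+k≡m : k ℕ.+ k ≡ m
  k+k≡m = tournamentMatrix-rowSum⇒k+k≡m m B k tm rowSum
  n≡1+2K : n ≡ 1ℚ + (K + K)
  n≡1+2K = begin
    ℕtoℚ (suc m)             ≡⟨ ℕtoℚ-+ 1 m ⟩
    1ℚ + ℕtoℚ m              ≡⟨ cong (λ j → 1ℚ + ℕtoℚ j) k+k≡m ⟨
    1ℚ + ℕtoℚ (k ℕ.+ k)      ≡⟨ cong (1ℚ +_) (ℕtoℚ-+ k k) ⟩
    1ℚ + (K + K)             ∎
  reflected : Q ≡ det m (λ r c → charMatrix z B′ r c + 1ℚ)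
  reflected = begin
    Q                                                      ≡⟨ charPoly-reflect m B′ (λ r c → tm (suc r) (suc c)) z ⟩
    sign m * det m (λ r c → charMatrix z B′ r c + 1ℚ)      ≡⟨ cong (_* det m (λ r c → charMatrix z B′ r c + 1ℚ))
                                                                (subst (λ j → sign j ≡ 1ℚ) k+k≡m (sign-even k)) ⟩
    1ℚ * det m (λ r c → charMatrix z B′ r c + 1ℚ)          ≡⟨ ℚP.*-identityˡ _ ⟩
    det m (λ r c → charMatrix z B′ r c + 1ℚ)               ∎
  closing : ∀ z K P Q →
    (z - K) * (((1ℚ + (K + K)) + (z - K)) * P - (z - K) * Q)
      ≡ ½ * ((z - ½ * ((1ℚ + (K + K)) - 1ℚ))
          * (((1ℚ + (K + K)) + (1ℚ + 1ℚ) * z + 1ℚ) * P + ((1ℚ + (K + K)) - (1ℚ + 1ℚ) * z - 1ℚ) * Q))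
  closing = solve-∀ ℚ-ring

adjacency-isTournamentMatrix : ∀ {n} (T : Tournament n) → IsTournamentMatrix (adjacency T)
adjacency-isTournamentMatrix T r c = by-cases (r FinP.≟ c)
  where
  indicator : Bool → ℚ
  indicator b = if b then 1ℚ else 0ℚ
  indicator-not : ∀ b b′ → b ≡ not b′ → indicator b + indicator b′ ≡ 1ℚ
  indicator-not _ true  refl = refl
  indicator-not _ false refl = refl
  by-cases : Dec (r ≡ c) → adjacency T r c + adjacency T c r ≡ 1ℚ - δ r c
  by-cases (yes refl) = trans (cong (λ b → indicator b + indicator b) (irrefl T r)) (cong (λ d → 1ℚ - d) (sym (δ-refl r)))
  by-cases (no r≢c)   = trans (indicator-not (dom T r c) (dom T c r) (oneArc T r c r≢c)) (cong (λ d → 1ℚ - d) (sym (δ-≢ r≢c)))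

adjacency-rowSum : ∀ {n} (T : Tournament n) r → ∑[ c < n ] adjacency T r c ≡ ℕtoℚ (outDegree T r)
adjacency-rowSum {n} T r = ∑-indicator n (dom T r)

lemma4p2 : (m : ℕ) (T : Tournament (suc m)) → Regular T → (i : Fin (suc m)) → (z : ℚ) →
    charPoly (suc m) (adjacency T) z
      ≡ ½ * ((z - ½ * (ℕtoℚ (suc m) - 1ℚ))
          * ((ℕtoℚ (suc m) + ℕtoℚ 2 * z + 1ℚ) * charPoly m (principalMinor (adjacency T) i) z
             + (ℕtoℚ (suc m) - ℕtoℚ 2 * z - 1ℚ) * charPoly m (principalMinor (adjacency T) i) (- z - 1ℚ)))
-- Relabelling by toFront i makes principalMinor (adjacency T) i the principal minor at 0.
lemma4p2 m T (k , regular) i z =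
  trans (sym (charPoly-conjugate-toFront m i A z)) (charPoly-regularTournamentMatrix m Aᵢ k tmᵢ rowSumᵢ z)
  where
  A Aᵢ : Matrix (suc m)
  A = adjacency T
  Aᵢ r c = A (toFront i r) (toFront i c)
  tmᵢ : IsTournamentMatrix Aᵢ
  tmᵢ r c = trans (adjacency-isTournamentMatrix T (toFront i r) (toFront i c))
                    (cong (λ d → 1ℚ - d) (δ-injective (toFront i) (toFront-injective i) r c))
  rowSumᵢ : ∀ r → ∑[ c < suc m ] Aᵢ r c ≡ ℕtoℚ k
  rowSumᵢ r = trans (∑-toFront m i (A (toFront i r)))
                    (trans (adjacency-rowSum T (toFront i r)) (cong ℕtoℚ (regular (toFront i r))))
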